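{- In the condition algebra described in the context (with any fixed parameter $\operatorname{limit}\geq 3$), for every admissible condition $A$: (1) if $A\neq I$ (in the condition algebra), then $A$ contains a condition variable or an atomic condition as a subterm; (2) the equation $AA^- = I$ holds if and only if $A = I$.
   Context: Conditions are terms built from condition variables $X,Y,Z,\dots$ and atomic conditions (elements of a countably infinite set $\operatorname{Coat}$ of free constants) by the operations: binary product $AB$, the constant $I$, and the unary operations $A^-$, $A^0$, $A^1$ and $\langle A\rangle$ (bracket). The size of a condition term is defined syntactically: $\operatorname{size}(I)=0$; $\operatorname{size}(X)=1$ for a variable; $\operatorname{size}(A)=1$ for $A$ atomic; $\operatorname{size}(\langle A\rangle)=1$; $\operatorname{size}(AB)=\operatorname{size}(A)+\operatorname{size}(B)$; $\operatorname{size}(A^-)=\operatorname{size}(A^0)=\operatorname{size}(A^1)=\operatorname{size}(A)$. A fixed parameter $\operatorname{limit}\geq 3$ is given, and every admissible condition term must be limited: every subterm $B$ has $\operatorname{size}(B)\leq\operatorname{limit}$. Copy exponents: for a position $p$ in a term $t$, $t/p$ is the subterm at $p$, and the copy exponent $t\uparrow p$ is the sequence of exponents $0,1$ (coming from the operations $(\cdot)^0,(\cdot)^1$) encountered while walking from $p$ up to the root of $t$, in that order. A term $t$ has unique copy exponents if, whenever $s$ is an atomic condition or a variable and $p\neq p'$ are positions with $t/p=t/p'=s$, the words $t\uparrow p$ and $t\uparrow p'$ are incomparable in the prefix order. Every admissible condition term must be limited and have unique copy exponents; in particular the product is a partial operation. Equality $=$ on conditions is the congruent equivalence generated by the equations $(AB)C=A(BC)$,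 $AB=BA$, $AI=A$, $A^{ -- }=A$, $(AB)^-=A^-B^-$, $(AB)^0=A^0B^0$, $(AB)^1=A^1B^1$, $\langle I\rangle=I$, $\langle A\rangle\langle B\rangle=\langle AB\rangle$, $A^0A^{1- }=I$, $A^0A^1=A$, where an equation is valid only if both of its sides are admissible (limited and with unique copy exponents), and replacements preserve admissibility. -}

module Defs where

open import Data.Nat using (ℕ; _≤_)
open import Data.List using (List; []; _∷_; _++_)
open import Data.Product using (_×_; ∃; ∃-syntax)
open import Relation.Binary.PropositionalEquality using (_≡_; _≢_)
open import Relation.Nullary using (¬_)
open import Relation.Binary.Construct.Closure.Equivalence using (EqClosure)

-- Condition terms. Condition variables and atomic conditions (the countably
-- infinite set Coat of free constants) are both indexed by ℕ.
infixl 7 _·_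
infix 9 _⁻ _⁰ _¹

data Cond : Set where
  var  : ℕ → Cond
  atom : ℕ → Cond
  _·_  : Cond → Cond → Cond
  I    : Cond
  _⁻   : Cond → Cond
  _⁰   : Cond → Cond
  _¹   : Cond → Cond
  ⟨_⟩  : Cond → Cond

size : Cond → ℕ
size (var _)  = 1
size (atom _) = 1
size (a · b)  = size a Data.Nat.+ size b
size I        = 0
size (a ⁻)    = size a
size (a ⁰)    = size a
size (a ¹)    = size a
size ⟨ a ⟩    = 1

data Pos : Cond → Set where
  here : ∀ {t} → Pos t
  inl  : ∀ {a b} → Pos a → Pos (a · b)
  inr  : ∀ {a b} → Pos b → Pos (a · b)
  in⁻  : ∀ {a} → Pos a → Pos (a ⁻)
  in⁰  : ∀ {a} → Pos a → Pos (a ⁰)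
  in¹  : ∀ {a} → Pos a → Pos (a ¹)
  in⟨⟩ : ∀ {a} → Pos a → Pos ⟨ a ⟩

_/_ : (t : Cond) → Pos t → Cond
t       / here   = t
(a · b) / inl p  = a / p
(a · b) / inr p  = b / p
(a ⁻)   / in⁻ p  = a / p
(a ⁰)   / in⁰ p  = a / p
(a ¹)   / in¹ p  = a / p
⟨ a ⟩   / in⟨⟩ p = a / p

data Bit : Set where
  b0 b1 : Bit

-- t ↑ p : copy exponent, the exponents 0,1 met walking from p up to the root
-- (innermost first, root-most last).
_↑_ : (t : Cond) → Pos t → List Bit
t       ↑ here   = []
(a · b) ↑ inl p  = a ↑ p
(a · b) ↑ inr p  = b ↑ p
(a ⁻)   ↑ in⁻ p  = a ↑ p
(a ⁰)   ↑ in⁰ p  = (a ↑ p) ++ (b0 ∷ [])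
(a ¹)   ↑ in¹ p  = (a ↑ p) ++ (b1 ∷ [])
⟨ a ⟩   ↑ in⟨⟩ p = a ↑ p

_≼_ : List Bit → List Bit → Set
u ≼ w = ∃[ r ] (u ++ r ≡ w)

data IsLeaf : Cond → Set where
  var-leaf  : ∀ n → IsLeaf (var n)
  atom-leaf : ∀ n → IsLeaf (atom n)

Limited : ℕ → Cond → Set
Limited L t = (p : Pos t) → size (t / p) ≤ L

-- incomparable in the prefix order: neither is a prefix of the other
-- (quantifying over both orders of p, p')
UniqueCopyExponents : Cond → Set
UniqueCopyExponents t =
  (p p' : Pos t) → p ≢ p' → IsLeaf (t / p) → t / p ≡ t / p' → ¬ ((t ↑ p) ≼ (t ↑ p'))

Admissible : ℕ → Cond → Set
Admissible L t = Limited L t × UniqueCopyExponents t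

data Axiom : Cond → Cond → Set where
  assoc   : ∀ A B C → Axiom ((A · B) · C) (A · (B · C))
  comm    : ∀ A B → Axiom (A · B) (B · A)
  unit    : ∀ A → Axiom (A · I) A
  invol   : ∀ A → Axiom (A ⁻ ⁻) A
  dist⁻   : ∀ A B → Axiom ((A · B) ⁻) (A ⁻ · B ⁻)
  dist⁰   : ∀ A B → Axiom ((A · B) ⁰) (A ⁰ · B ⁰)
  dist¹   : ∀ A B → Axiom ((A · B) ¹) (A ¹ · B ¹)
  bracketI : Axiom ⟨ I ⟩ I
  bracket· : ∀ A B → Axiom (⟨ A ⟩ · ⟨ B ⟩) ⟨ A · B ⟩
  copyInv : ∀ A → Axiom (A ⁰ · A ¹ ⁻) I
  copy    : ∀ A → Axiom (A ⁰ · A ¹) A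

data Ctx : Set where
  hole : Ctx
  _·ₗ_ : Ctx → Cond → Ctx
  _·ᵣ_ : Cond → Ctx → Ctx
  c⁻   : Ctx → Ctx
  c⁰   : Ctx → Ctx
  c¹   : Ctx → Ctx
  c⟨⟩  : Ctx → Ctx

plug : Ctx → Cond → Cond
plug hole     s = s
plug (C ·ₗ b) s = plug C s · b
plug (a ·ᵣ C) s = a · plug C s
plug (c⁻ C)   s = plug C s ⁻
plug (c⁰ C)   s = plug C s ⁰
plug (c¹ C)   s = plug C s ¹
plug (c⟨⟩ C)  s = ⟨ plug C s ⟩

data Step (L : ℕ) : Cond → Cond → Set where
  step : ∀ (C : Ctx) {l r} → Axiom l r →
         Admissible L l → Admissible L r →
         Admissible L (plug C l) → Admissible L (plug C r) →
         Step L (plug C l) (plug C r)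

_≈⟨_⟩_ : Cond → ℕ → Cond → Set
A ≈⟨ L ⟩ B = EqClosure (Step L) A B

module Submission where

-- Call a term leaf-free if it contains no condition variable
-- and no atomic condition.  The heart of the proof is that every limited
-- leaf-free term equals I.  Such a term is built from I by products,
-- brackets and the operations ⁻, ⁰, ¹, so it can be collapsed bottom-up:
-- I⁰, I¹, I⁻ and ⟨I⟩ each reduce to I, and I · I reduces to I.  Every
-- intermediate term stays leaf-free (so it trivially has unique copy
-- exponents) and never grows in size (so it stays limited), so every
-- rewriting step is admissible.
--   (1) follows at once: a term that has no leaf equals I.
--   (2) If A · A⁻ is admissible, A is leaf-free: a leaf of A would occur
--       at the same position in A and in A⁻, with the same copy exponent,
--       violating unique copy exponents.  So both A and A · A⁻ equal I
--       and the equivalence holds.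

open import Defs
open import Data.Nat using (ℕ; _≤_; _+_; z≤n)
open import Data.Nat.Properties using (≤-trans; ≤-refl; +-monoˡ-≤; +-monoʳ-≤; m≤n+m)
open import Data.Product using (_×_; ∃-syntax; _,_; proj₁; proj₂)
open import Data.Sum using (_⊎_; inj₁; inj₂)
open import Data.Unit using (⊤; tt)
open import Data.Empty using (⊥; ⊥-elim)
open import Data.List using ([])
open import Data.List.Properties using (++-identityʳ)
open import Relation.Nullary using (¬_)
open import Relation.Binary.Bundles using (Setoid)
open import Relation.Binary.PropositionalEquality using (_≡_; refl; subst; subst₂; sym; cong)
open import Relation.Binary.Construct.Closure.ReflexiveTransitive using (ε; _◅_; _◅◅_)
open import Relation.Binary.Construct.Closure.Symmetric using (fwd)
open import Relation.Binary.Construct.Closure.Equivalence using (symmetric)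
open import Function.Bundles using (_⇔_; mk⇔)
import Relation.Binary.Reasoning.Setoid as SetoidReasoning
open import Relation.Binary.Reasoning.Syntax using (module ≃-syntax)

LeafFree : Cond → Set
LeafFree (var _)  = ⊥
LeafFree (atom _) = ⊥
LeafFree (a · b)  = LeafFree a × LeafFree b
LeafFree I        = ⊤
LeafFree (a ⁻)    = LeafFree a
LeafFree (a ⁰)    = LeafFree a
LeafFree (a ¹)    = LeafFree a
LeafFree ⟨ a ⟩    = LeafFree a

leafFree⇒noLeaf : ∀ t → LeafFree t → (p : Pos t) → ¬ IsLeaf (t / p)
leafFree⇒noLeaf (a · b) (fa , _) (inl p)  = leafFree⇒noLeaf a fa p
leafFree⇒noLeaf (a · b) (_ , fb) (inr p)  = leafFree⇒noLeaf b fb p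
leafFree⇒noLeaf (a ⁻)   f        (in⁻ p)  = leafFree⇒noLeaf a f p
leafFree⇒noLeaf (a ⁰)   f        (in⁰ p)  = leafFree⇒noLeaf a f p
leafFree⇒noLeaf (a ¹)   f        (in¹ p)  = leafFree⇒noLeaf a f p
leafFree⇒noLeaf ⟨ a ⟩   f        (in⟨⟩ p) = leafFree⇒noLeaf a f p
leafFree⇒noLeaf (a · b) _ here ()
leafFree⇒noLeaf I       _ here ()
leafFree⇒noLeaf (a ⁻)   _ here ()
leafFree⇒noLeaf (a ⁰)   _ here ()
leafFree⇒noLeaf (a ¹)   _ here ()
leafFree⇒noLeaf ⟨ a ⟩   _ here ()

leaf-or-leafFree : ∀ t → (∃[ p ] IsLeaf (t / p)) ⊎ LeafFree t
leaf-or-leafFree (var n)  = inj₁ (here , var-leaf n)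
leaf-or-leafFree (atom n) = inj₁ (here , atom-leaf n)
leaf-or-leafFree I        = inj₂ tt
leaf-or-leafFree (a · b) with leaf-or-leafFree a | leaf-or-leafFree b
... | inj₁ (p , l) | _            = inj₁ (inl p , l)
... | inj₂ _       | inj₁ (p , l) = inj₁ (inr p , l)
... | inj₂ fa      | inj₂ fb      = inj₂ (fa , fb)
leaf-or-leafFree (a ⁻) with leaf-or-leafFree a
... | inj₁ (p , l) = inj₁ (in⁻ p , l)
... | inj₂ f       = inj₂ f
leaf-or-leafFree (a ⁰) with leaf-or-leafFree a
... | inj₁ (p , l) = inj₁ (in⁰ p , l)
... | inj₂ f       = inj₂ f
leaf-or-leafFree (a ¹) with leaf-or-leafFree a
... | inj₁ (p , l) = inj₁ (in¹ p , l)
... | inj₂ f       = inj₂ f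
leaf-or-leafFree ⟨ a ⟩ with leaf-or-leafFree a
... | inj₁ (p , l) = inj₁ (in⟨⟩ p , l)
... | inj₂ f       = inj₂ f

leafFree⇒unique : ∀ t → LeafFree t → UniqueCopyExponents t
leafFree⇒unique t f p _ _ l _ _ = leafFree⇒noLeaf t f p l

-- A leaf of A sits at the same position, with the same copy exponent, in the
-- factors A and A⁻ of A · A⁻; so an admissible A · A⁻ forces A leaf-free.
square-admissible⇒leafFree : ∀ {L} A → Admissible L (A · A ⁻) → LeafFree A
square-admissible⇒leafFree A (_ , unique) with leaf-or-leafFree A
... | inj₂ f       = f
... | inj₁ (p , l) =
  ⊥-elim (unique (inl p) (inr (in⁻ p)) (λ ()) l refl ([] , ++-identityʳ (A ↑ p)))

Bounded : ℕ → Cond → Set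
Bounded L (var _)  = 1 ≤ L
Bounded L (atom _) = 1 ≤ L
Bounded L (a · b)  = size a + size b ≤ L × Bounded L a × Bounded L b
Bounded L I        = ⊤
Bounded L (a ⁻)    = Bounded L a
Bounded L (a ⁰)    = Bounded L a
Bounded L (a ¹)    = Bounded L a
Bounded L ⟨ a ⟩    = 1 ≤ L × Bounded L a

bounded⇒size : ∀ {L} t → Bounded L t → size t ≤ L
bounded⇒size (var _)  b = b
bounded⇒size (atom _) b = b
bounded⇒size (a · c)  b = proj₁ b
bounded⇒size I        _ = z≤n
bounded⇒size (a ⁻)    b = bounded⇒size a b
bounded⇒size (a ⁰)    b = bounded⇒size a b
bounded⇒size (a ¹)    b = bounded⇒size a b
bounded⇒size ⟨ a ⟩    b = proj₁ b

bounded⇒limited : ∀ {L} t → Bounded L t → Limited L t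
bounded⇒limited t       b here     = bounded⇒size t b
bounded⇒limited (a · c) b (inl p)  = bounded⇒limited a (proj₁ (proj₂ b)) p
bounded⇒limited (a · c) b (inr p)  = bounded⇒limited c (proj₂ (proj₂ b)) p
bounded⇒limited (a ⁻)   b (in⁻ p)  = bounded⇒limited a b p
bounded⇒limited (a ⁰)   b (in⁰ p)  = bounded⇒limited a b p
bounded⇒limited (a ¹)   b (in¹ p)  = bounded⇒limited a b p
bounded⇒limited ⟨ a ⟩   b (in⟨⟩ p) = bounded⇒limited a (proj₂ b) p

limited⇒bounded : ∀ {L} t → Limited L t → Bounded L t
limited⇒bounded (var _)  lim = lim here
limited⇒bounded (atom _) lim = lim here
limited⇒bounded (a · b)  lim =
  lim here , limited⇒bounded a (λ p → lim (inl p)) , limited⇒bounded b (λ p → lim (inr p))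
limited⇒bounded I        _   = tt
limited⇒bounded (a ⁻)    lim = limited⇒bounded a (λ p → lim (in⁻ p))
limited⇒bounded (a ⁰)    lim = limited⇒bounded a (λ p → lim (in⁰ p))
limited⇒bounded (a ¹)    lim = limited⇒bounded a (λ p → lim (in¹ p))
limited⇒bounded ⟨ a ⟩    lim = lim here , limited⇒bounded a (λ p → lim (in⟨⟩ p))

_∘ᶜ_ : Ctx → Ctx → Ctx
hole     ∘ᶜ D = D
(C ·ₗ b) ∘ᶜ D = (C ∘ᶜ D) ·ₗ b
(a ·ᵣ C) ∘ᶜ D = a ·ᵣ (C ∘ᶜ D)
c⁻ C     ∘ᶜ D = c⁻ (C ∘ᶜ D)
c⁰ C     ∘ᶜ D = c⁰ (C ∘ᶜ D)
c¹ C     ∘ᶜ D = c¹ (C ∘ᶜ D)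
c⟨⟩ C    ∘ᶜ D = c⟨⟩ (C ∘ᶜ D)

plug-∘ : ∀ C D s → plug (C ∘ᶜ D) s ≡ plug C (plug D s)
plug-∘ hole     D s = refl
plug-∘ (C ·ₗ b) D s = cong (_· b) (plug-∘ C D s)
plug-∘ (a ·ᵣ C) D s = cong (a ·_) (plug-∘ C D s)
plug-∘ (c⁻ C)   D s = cong _⁻ (plug-∘ C D s)
plug-∘ (c⁰ C)   D s = cong _⁰ (plug-∘ C D s)
plug-∘ (c¹ C)   D s = cong _¹ (plug-∘ C D s)
plug-∘ (c⟨⟩ C)  D s = cong ⟨_⟩ (plug-∘ C D s)

size-plug-mono : ∀ C {s s'} → size s' ≤ size s → size (plug C s') ≤ size (plug C s)
size-plug-mono hole     h = h
size-plug-mono (C ·ₗ b) h = +-monoˡ-≤ (size b) (size-plug-mono C h)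
size-plug-mono (a ·ᵣ C) h = +-monoʳ-≤ (size a) (size-plug-mono C h)
size-plug-mono (c⁻ C)   h = size-plug-mono C h
size-plug-mono (c⁰ C)   h = size-plug-mono C h
size-plug-mono (c¹ C)   h = size-plug-mono C h
size-plug-mono (c⟨⟩ C)  h = ≤-refl

bounded-plug : ∀ {L} C {s s'} → Bounded L (plug C s) → Bounded L s' → size s' ≤ size s →
               Bounded L (plug C s')
bounded-plug hole     _                b' _ = b'
bounded-plug (C ·ₗ b) (bnd , bC , bb)  b' h =
  ≤-trans (+-monoˡ-≤ (size b) (size-plug-mono C h)) bnd , bounded-plug C bC b' h , bb
bounded-plug (a ·ᵣ C) (bnd , ba , bC)  b' h =
  ≤-trans (+-monoʳ-≤ (size a) (size-plug-mono C h)) bnd , ba , bounded-plug C bC b' h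
bounded-plug (c⁻ C)   bC               b' h = bounded-plug C bC b' h
bounded-plug (c⁰ C)   bC               b' h = bounded-plug C bC b' h
bounded-plug (c¹ C)   bC               b' h = bounded-plug C bC b' h
bounded-plug (c⟨⟩ C)  (one , bC)       b' h = one , bounded-plug C bC b' h

bounded-sub : ∀ {L} C {s} → Bounded L (plug C s) → Bounded L s
bounded-sub hole     b           = b
bounded-sub (C ·ₗ _) (_ , bC , _) = bounded-sub C bC
bounded-sub (_ ·ᵣ C) (_ , _ , bC) = bounded-sub C bC
bounded-sub (c⁻ C)   b           = bounded-sub C b
bounded-sub (c⁰ C)   b           = bounded-sub C b
bounded-sub (c¹ C)   b           = bounded-sub C b
bounded-sub (c⟨⟩ C)  (_ , bC)     = bounded-sub C bC

leafFree-plug : ∀ C {s s'} → LeafFree (plug C s) → LeafFree s' → LeafFree (plug C s')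
leafFree-plug hole     _         f' = f'
leafFree-plug (C ·ₗ _) (fC , fb) f' = leafFree-plug C fC f' , fb
leafFree-plug (_ ·ᵣ C) (fa , fC) f' = fa , leafFree-plug C fC f'
leafFree-plug (c⁻ C)   f         f' = leafFree-plug C f f'
leafFree-plug (c⁰ C)   f         f' = leafFree-plug C f f'
leafFree-plug (c¹ C)   f         f' = leafFree-plug C f f'
leafFree-plug (c⟨⟩ C)  f         f' = leafFree-plug C f f'

leafFree-sub : ∀ C {s} → LeafFree (plug C s) → LeafFree s
leafFree-sub hole     f        = f
leafFree-sub (C ·ₗ _) (fC , _) = leafFree-sub C fC
leafFree-sub (_ ·ᵣ C) (_ , fC) = leafFree-sub C fC
leafFree-sub (c⁻ C)   f        = leafFree-sub C f
leafFree-sub (c⁰ C)   f        = leafFree-sub C f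
leafFree-sub (c¹ C)   f        = leafFree-sub C f
leafFree-sub (c⟨⟩ C)  f        = leafFree-sub C f

-- Null terms: built from I by products and ⁻, ⁰, ¹ only.  They are the
-- bracket-free leaf-free terms; they have size 0, so they fit anywhere.
Null : Cond → Set
Null (var _)  = ⊥
Null (atom _) = ⊥
Null (a · b)  = Null a × Null b
Null I        = ⊤
Null (a ⁻)    = Null a
Null (a ⁰)    = Null a
Null (a ¹)    = Null a
Null ⟨ _ ⟩    = ⊥

null-size : ∀ x → Null x → size x ≡ 0
null-size (a · b) (na , nb) rewrite null-size a na | null-size b nb = refl
null-size I       _         = refl
null-size (a ⁻)   n         = null-size a n
null-size (a ⁰)   n         = null-size a n
null-size (a ¹)   n         = null-size a n

null⇒leafFree : ∀ x → Null x → LeafFree x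
null⇒leafFree (a · b) (na , nb) = null⇒leafFree a na , null⇒leafFree b nb
null⇒leafFree I       _         = tt
null⇒leafFree (a ⁻)   n         = null⇒leafFree a n
null⇒leafFree (a ⁰)   n         = null⇒leafFree a n
null⇒leafFree (a ¹)   n         = null⇒leafFree a n

null⇒bounded : ∀ {L} x → Null x → Bounded L x
null⇒bounded (a · b) (na , nb) rewrite null-size a na | null-size b nb =
  z≤n , null⇒bounded a na , null⇒bounded b nb
null⇒bounded I       _ = tt
null⇒bounded (a ⁻)   n = null⇒bounded a n
null⇒bounded (a ⁰)   n = null⇒bounded a n
null⇒bounded (a ¹)   n = null⇒bounded a n

module Collapse (L : ℕ) where

  infix 4 _≈_ _≃_

  _≈_ : Cond → Cond → Set
  x ≈ y = x ≈⟨ L ⟩ y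

  Good : Cond → Set
  Good t = LeafFree t × Bounded L t

  good⇒admissible : ∀ t → Good t → Admissible L t
  good⇒admissible t (f , b) = bounded⇒limited t b , leafFree⇒unique t f

  good-plug : ∀ C {s s'} → Good (plug C s) → Good s' → size s' ≤ size s → Good (plug C s')
  good-plug C (f , b) (f' , b') h = leafFree-plug C f f' , bounded-plug C b b' h

  GoodCtx : Ctx → Set
  GoodCtx C = Good (plug C I)

  good⇒goodCtx : ∀ C {s} → Good (plug C s) → GoodCtx C
  good⇒goodCtx C g = good-plug C g (tt , tt) z≤n

  null⇒good : ∀ x → Null x → Good x
  null⇒good x n = null⇒leafFree x n , null⇒bounded x n

  null-in-goodCtx : ∀ C {x} → GoodCtx C → Null x → Good (plug C x)
  null-in-goodCtx C {x} g n = good-plug C g (null⇒good x n) (subst (_≤ 0) (sym (null-size x n)) z≤n)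

  axiom-step : ∀ C {l r} → Axiom l r → Good l → Good r → Good (plug C l) → Good (plug C r) →
               plug C l ≈ plug C r
  axiom-step C {l} {r} ax gl gr gCl gCr =
    fwd (step C ax (good⇒admissible l gl) (good⇒admissible r gr)
                   (good⇒admissible (plug C l) gCl) (good⇒admissible (plug C r) gCr)) ◅ ε

  _≃_ : Cond → Cond → Set
  x ≃ y = ∀ C → GoodCtx C → plug C x ≈ plug C y

  ≃-setoid : Setoid _ _
  ≃-setoid = record
    { _≈_ = _≃_
    ; isEquivalence = record
      { refl  = λ _ _ → ε
      ; sym   = λ x≃y C g → symmetric _ (x≃y C g)
      ; trans = λ x≃y y≃z C g → x≃y C g ◅◅ y≃z C g
      }
    }

  axiom-≃ : ∀ {l r} → Axiom l r → {Null l} → {Null r} → l ≃ r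
  axiom-≃ {l} {r} ax {nl} {nr} C g =
    axiom-step C ax (null⇒good l nl) (null⇒good r nr)
                    (null-in-goodCtx C g nl) (null-in-goodCtx C g nr)

  ≃-cong : ∀ D → {Null (plug D I)} → ∀ {x y} → x ≃ y → plug D x ≃ plug D y
  ≃-cong D {n} {x} {y} x≃y C g =
    subst₂ _≈_ (plug-∘ C D x) (plug-∘ C D y)
      (x≃y (C ∘ᶜ D) (subst Good (sym (plug-∘ C D I)) (null-in-goodCtx C g n)))

  open SetoidReasoning ≃-setoid using (begin_; _∎; _IsRelatedTo_; ≈-go)
  open ≃-syntax _IsRelatedTo_ _IsRelatedTo_ ≈-go (Setoid.sym ≃-setoid)

  I⁰≃I : I ⁰ ≃ I
  I⁰≃I = begin
    I ⁰                       ≃⟨ axiom-≃ (unit (I ⁰)) ⟨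
    I ⁰ · I                   ≃⟨ ≃-cong ((I ⁰) ·ᵣ hole) (axiom-≃ (copyInv I)) ⟨
    I ⁰ · (I ⁰ · I ¹ ⁻)       ≃⟨ axiom-≃ (assoc (I ⁰) (I ⁰) (I ¹ ⁻)) ⟨
    (I ⁰ · I ⁰) · I ¹ ⁻       ≃⟨ ≃-cong (hole ·ₗ (I ¹ ⁻)) (axiom-≃ (dist⁰ I I)) ⟨
    (I · I) ⁰ · I ¹ ⁻         ≃⟨ ≃-cong (c⁰ hole ·ₗ (I ¹ ⁻)) (axiom-≃ (unit I)) ⟩
    I ⁰ · I ¹ ⁻               ≃⟨ axiom-≃ (copyInv I) ⟩
    I                         ∎

  absorbed-by-I⁰ : ∀ x → {Null x} → Axiom (I ⁰ · x) I → x ≃ I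
  absorbed-by-I⁰ x {n} ax = begin
    x                ≃⟨ axiom-≃ (unit x) {n , tt} {n} ⟨
    x · I            ≃⟨ axiom-≃ (comm x I) {n , tt} {tt , n} ⟩
    I · x            ≃⟨ ≃-cong (hole ·ₗ x) {tt , n} I⁰≃I ⟨
    I ⁰ · x          ≃⟨ axiom-≃ ax {tt , n} ⟩
    I                ∎

  I¹≃I : I ¹ ≃ I
  I¹≃I = absorbed-by-I⁰ (I ¹) (copy I)

  I¹⁻≃I : I ¹ ⁻ ≃ I
  I¹⁻≃I = absorbed-by-I⁰ (I ¹ ⁻) (copyInv I)

  I⁻≃I : I ⁻ ≃ I
  I⁻≃I = begin
    I ⁻              ≃⟨ ≃-cong (c⁻ hole) I¹≃I ⟨
    I ¹ ⁻            ≃⟨ I¹⁻≃I ⟩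
    I                ∎

  -- The collapse: inside any context, a good term can be replaced by I.
  -- Subterms are collapsed first, in the composed context C ∘ᶜ D.
  mutual
    collapse : ∀ C t → Good (plug C t) → plug C t ≈ plug C I
    collapse C (var _)  (f , _) = ⊥-elim (leafFree-sub C f)
    collapse C (atom _) (f , _) = ⊥-elim (leafFree-sub C f)
    collapse C I        _       = ε
    collapse C (a · b)  g       =
      collapse-inside C (hole ·ₗ b) a g ◅◅ (collapse-inside C (I ·ᵣ hole) b gIb ◅◅
      axiom-≃ (unit I) C (good⇒goodCtx C g))
      where
      bounded-b : Bounded L b
      bounded-b = proj₂ (proj₂ (bounded-sub C (proj₂ g)))
      gIb : Good (plug C (I · b))
      gIb = good-plug C g ((tt , proj₂ (leafFree-sub C (proj₁ g))) ,
                           (bounded⇒size b bounded-b , tt , bounded-b))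
                          (m≤n+m (size b) (size a))
    collapse C (a ⁻) g = collapse-inside C (c⁻ hole) a g ◅◅ I⁻≃I C (good⇒goodCtx C g)
    collapse C (a ⁰) g = collapse-inside C (c⁰ hole) a g ◅◅ I⁰≃I C (good⇒goodCtx C g)
    collapse C (a ¹) g = collapse-inside C (c¹ hole) a g ◅◅ I¹≃I C (good⇒goodCtx C g)
    collapse C ⟨ a ⟩ g =
      collapse-inside C (c⟨⟩ hole) a g ◅◅
      axiom-step C bracketI (tt , bracket-fits) (tt , tt)
                 (good-plug C g (tt , bracket-fits) ≤-refl) (good⇒goodCtx C g)
      where
      bracket-fits : Bounded L ⟨ I ⟩
      bracket-fits = proj₁ (bounded-sub C (proj₂ g)) , tt

    collapse-inside : ∀ C D a → Good (plug C (plug D a)) → plug C (plug D a) ≈ plug C (plug D I)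
    collapse-inside C D a g =
      subst₂ _≈_ (plug-∘ C D a) (plug-∘ C D I)
        (collapse (C ∘ᶜ D) a (subst Good (sym (plug-∘ C D a)) g))

  leafFree⇒≈I : ∀ A → LeafFree A → Limited L A → A ≈ I
  leafFree⇒≈I A f lim = collapse hole A (f , limited⇒bounded A lim)

proposition4p4 : (L : ℕ) → 3 ≤ L → (A : Cond) → Admissible L A →
    ((¬ (A ≈⟨ L ⟩ I) → ∃[ p ] IsLeaf (A / p))
    × (Admissible L (A · A ⁻) → ((A · A ⁻) ≈⟨ L ⟩ I) ⇔ (A ≈⟨ L ⟩ I)))
proposition4p4 L _ A (limA , _) = has-leaf , square≈I⇔≈I
  where
  open Collapse L using (leafFree⇒≈I)

  has-leaf : ¬ (A ≈⟨ L ⟩ I) → ∃[ p ] IsLeaf (A / p)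
  has-leaf A≉I with leaf-or-leafFree A
  ... | inj₁ leaf = leaf
  ... | inj₂ f    = ⊥-elim (A≉I (leafFree⇒≈I A f limA))

  -- Both sides hold: A · A⁻ admissible makes A, hence A · A⁻, leaf-free.
  square≈I⇔≈I : Admissible L (A · A ⁻) → ((A · A ⁻) ≈⟨ L ⟩ I) ⇔ (A ≈⟨ L ⟩ I)
  square≈I⇔≈I adm@(limAA , _) =
    mk⇔ (λ _ → leafFree⇒≈I A f limA) (λ _ → leafFree⇒≈I (A · A ⁻) (f , f) limAA)
    where
    f : LeafFree A
    f = square-admissible⇒leafFree A adm
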